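{- Let $m\geq 2$, $n_1,\ldots,n_m\geq 2$ integers, $N=n_1\cdots n_m$, $M=N/n_m$, and $\omega=\exp(2\pi i/N)$. Let $\sigma=(1\ 2\ \ldots\ m)\in Sym(m)$. Then the matrix $F_N(\omega)\,(P^{\sigma}_{n_1,\ldots,n_m})^T$, partitioned into $n_m\times n_m$ blocks $B_{hk}$ ($h,k=0,\ldots,n_m-1$), each of size $M\times M$ (block $B_{hk}$ occupying rows $hM,\ldots,hM+M-1$ and columns $kM,\ldots,kM+M-1$), satisfies $$B_{hk}=\omega^{Nhk/n_m}\cdot D_{M}(\omega^{k})\cdot F_{M}(\omega^{n_m})\qquad\text{for all } h,k=0,\ldots,n_m-1.$$
   Context: For a positive integer $s$ and a complex number $z$, $F_s(z)$ is the $s\times s$ matrix $(z^{ij})_{i,j=0,\ldots,s-1}$ (so $F_N(\omega)$ is the discrete Fourier transform matrix), and $D_s(z)=\mathrm{diag}(z^0,z^1,\ldots,z^{s-1})$. For positive integers $a,b$ and $1\le i\le a$, $1\le j\le b$, $E^{i,j}_{a\times b}$ denotes the $a\times b$ real matrix with entry $1$ in row $i$, column $j$ and $0$ elsewhere; $\otimes$ is the Kronecker product. The shuffling matrix is the $N\times N$ permutation matrix $$P^{\sigma}_{n_1,\ldots,n_m}=\sum_{\substack{i_j=1,\ldots,n_j\\ j=1,\ldots,m}} E^{i_{\sigma^{ -1}(1)},i_1}_{n_{\sigma^{ -1}(1)}\times n_1}\otimes\cdots\otimes E^{i_{\sigma^{ -1}(m)},i_m}_{n_{\sigma^{ -1}(m)}\times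 n_m}.$$ Rows and columns of $N\times N$ matrices are indexed by $\{0,\ldots,N-1\}$. -}

module Defs where

open import Data.Nat using (ℕ; zero; suc)
import Data.Nat as ℕ
open import Data.Fin using (Fin; zero; suc; _≟_; combine; remQuot)
open import Data.Fin.Permutation using (Permutation′; _⟨$⟩ˡ_)
open import Data.Product using (_,_)
open import Data.Bool using (if_then_else_; _∧_)
open import Relation.Nullary.Decidable using (⌊_⌋)
open import Algebra.Bundles using (CommutativeRing)

prodℕ : (m : ℕ) → (Fin m → ℕ) → ℕ
prodℕ zero    n = 1
prodℕ (suc m) n = n zero ℕ.* prodℕ m (λ j → n (suc j))

consIdx : {m : ℕ} {n : Fin (suc m) → ℕ} → Fin (n zero) →
          ((j : Fin m) → Fin (n (suc j))) → (j : Fin (suc m)) → Fin (n j)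
consIdx a rest zero    = a
consIdx a rest (suc j) = rest j

module _ {c ℓ} (R : CommutativeRing c ℓ) where
  open CommutativeRing R using (Carrier; _+_; _*_; 0#; 1#)

  Matrix : ℕ → ℕ → Set c
  Matrix a b = Fin a → Fin b → Carrier

  pow : Carrier → ℕ → Carrier
  pow x zero    = 1#
  pow x (suc k) = x * pow x k

  sumFin : (n : ℕ) → (Fin n → Carrier) → Carrier
  sumFin zero    f = 0#
  sumFin (suc n) f = f zero + sumFin n (λ i → f (suc i))

  sumMulti : (m : ℕ) (n : Fin m → ℕ) → (((j : Fin m) → Fin (n j)) → Carrier) → Carrier
  sumMulti zero    n f = f (λ ())
  sumMulti (suc m) n f =
    sumFin (n zero) (λ a → sumMulti m (λ j → n (suc j)) (λ rest → f (consIdx {n = n} a rest)))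

  _·M_ : ∀ {a b d} → Matrix a b → Matrix b d → Matrix a d
  (A ·M B) i k = sumFin _ (λ j → A i j * B j k)

  _+M_ : ∀ {a b} → Matrix a b → Matrix a b → Matrix a b
  (A +M B) i j = A i j + B i j

  zeroM : ∀ {a b} → Matrix a b
  zeroM i j = 0#

  transpose : ∀ {a b} → Matrix a b → Matrix b a
  transpose A i j = A j i

  scale : ∀ {a b} → Carrier → Matrix a b → Matrix a b
  scale x A i j = x * A i j

  F : (s : ℕ) → Carrier → Matrix s s
  F s z i j = pow z (Data.Fin.toℕ i ℕ.* Data.Fin.toℕ j)

  D : (s : ℕ) → Carrier → Matrix s s
  D s z i j = if ⌊ i ≟ j ⌋ then pow z (Data.Fin.toℕ i) else 0#

  E : (a b : ℕ) → Fin a → Fin b → Matrix a b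
  E a b i j r s = if ⌊ r ≟ i ⌋ ∧ ⌊ s ≟ j ⌋ then 1# else 0#

  -- Kronecker product; row index (i,k) ↦ i*c + k (lexicographic)
  _⊗_ : ∀ {a b c' d} → Matrix a b → Matrix c' d → Matrix (a ℕ.* c') (b ℕ.* d)
  _⊗_ {a} {b} {c'} {d} A B r s with remQuot c' r | remQuot d s
  ... | i , k | j , l = A i j * B k l

  kron : (m : ℕ) (r s : Fin m → ℕ) → ((j : Fin m) → Matrix (r j) (s j)) →
         Matrix (prodℕ m r) (prodℕ m s)
  kron zero    r s A = λ _ _ → 1#
  kron (suc m) r s A = A zero ⊗ kron m (λ j → r (suc j)) (λ j → s (suc j)) (λ j → A (suc j))

  -- Shuffling matrix P^σ_{n_1,…,n_m} (0-based indices, σ⁻¹ = σ ⟨$⟩ˡ_):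
  --   Σ_{i} E^{i_{σ⁻¹(0)}, i_0} ⊗ ⋯ ⊗ E^{i_{σ⁻¹(m-1)}, i_{m-1}}
  -- of size (∏ n_{σ⁻¹(j)}) × (∏ n_j)  (both products equal N).
  shuffle : (m : ℕ) (n : Fin m → ℕ) (σ : Permutation′ m) →
            Matrix (prodℕ m (λ j → n (σ ⟨$⟩ˡ j))) (prodℕ m n)
  shuffle m n σ r s =
    sumMulti m n (λ i →
      kron m (λ j → n (σ ⟨$⟩ˡ j)) n
             (λ j → E (n (σ ⟨$⟩ˡ j)) (n j) (i (σ ⟨$⟩ˡ j)) (i j)) r s)

-- Reading indices as mixed-radix numerals, the digits of s are those of t with
-- the last digit moved to the front exactly when P^σ has a 1 at (s, t).  So
-- row s = kk·M + b of P^σ is the unit vector at t = b·n_m + kk, the (r, s) entry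
-- of F_N(ω)(P^σ)ᵀ is ω^(r t), and for r = h·M + a the exponent
-- (h M + a)(b n_m + kk) ≡ M h kk + kk a + n_m a b  (mod N = M n_m)
-- gives exactly the corresponding entry of ω^(M h kk) D_M(ω^kk) F_M(ω^(n_m)).
module Submission where

open import Data.Nat using (ℕ; zero; suc; _+_; _*_; _≤_; _<_; _%_; z≤n; s≤s)
import Data.Nat.Properties as ℕ
open import Data.Nat.DivMod using (m<n⇒m%n≡m; n%n≡0)
open import Data.Nat.Tactic.RingSolver using (solve-∀)
open import Data.Fin using (Fin; zero; suc; toℕ; fromℕ; fromℕ<; inject₁; quotient; remainder; combine; _≟_)
open import Data.Fin.Properties
  using (toℕ<n; toℕ-injective; toℕ-fromℕ; toℕ-inject₁; toℕ-fromℕ<; toℕ-combine; combine-remQuot;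
         punchInᵢ≢i; ¬∀⟶∃¬)
open import Data.Fin.Permutation using (Permutation′; _⟨$⟩ʳ_; _⟨$⟩ˡ_; inverseˡ)
open import Data.Vec.Functional using (removeAt; replicate)
open import Data.Product using (_×_; _,_)
open import Data.Empty using (⊥-elim)
open import Function using (_∘_)
open import Relation.Binary.PropositionalEquality
  using (_≡_; _≢_; refl; sym; trans; cong; cong₂; subst; subst₂; module ≡-Reasoning)
open import Relation.Nullary using (¬_; yes; no)
open import Algebra.Bundles using (CommutativeRing)
open import Defs

prodℕ-cong : ∀ m {r r′ : Fin m → ℕ} → (∀ j → r j ≡ r′ j) → prodℕ m r ≡ prodℕ m r′
prodℕ-cong zero    r≗r′ = refl
prodℕ-cong (suc m) r≗r′ = cong₂ _*_ (r≗r′ zero) (prodℕ-cong m (r≗r′ ∘ suc))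

prodℕ-init-last : ∀ m (r : Fin (suc m) → ℕ) →
                  prodℕ (suc m) r ≡ prodℕ m (r ∘ inject₁) * r (fromℕ m)
prodℕ-init-last zero    r = ℕ.*-comm (r zero) 1
prodℕ-init-last (suc m) r =
  trans (cong (r zero *_) (prodℕ-init-last m (r ∘ suc))) (sym (ℕ.*-assoc (r zero) _ _))

value : (m : ℕ) → (Fin m → ℕ) → (Fin m → ℕ) → ℕ
value zero    r d = 0
value (suc m) r d = d zero * prodℕ m (r ∘ suc) + value m (r ∘ suc) (d ∘ suc)

value-cong : ∀ m {r r′ d d′ : Fin m → ℕ} → (∀ j → r j ≡ r′ j) → (∀ j → d j ≡ d′ j) →
             value m r d ≡ value m r′ d′
value-cong zero    r≗r′ d≗d′ = refl
value-cong (suc m) r≗r′ d≗d′ =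
  cong₂ _+_ (cong₂ _*_ (d≗d′ zero) (prodℕ-cong m (r≗r′ ∘ suc)))
            (value-cong m (r≗r′ ∘ suc) (d≗d′ ∘ suc))

value-init-last : ∀ m (r d : Fin (suc m) → ℕ) →
  value (suc m) r d ≡ value m (r ∘ inject₁) (d ∘ inject₁) * r (fromℕ m) + d (fromℕ m)
value-init-last zero    r d = trans (ℕ.+-identityʳ _) (ℕ.*-identityʳ (d zero))
value-init-last (suc m) r d = begin
  d zero * prodℕ (suc m) (r ∘ suc) + value (suc m) (r ∘ suc) (d ∘ suc)
    ≡⟨ cong₂ _+_ (cong (d zero *_) (prodℕ-init-last m (r ∘ suc))) (value-init-last m (r ∘ suc) (d ∘ suc)) ⟩
  d zero * (P * rₗ) + (V * rₗ + dₗ)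
    ≡⟨ regroup (d zero) P rₗ V dₗ ⟩
  (d zero * P + V) * rₗ + dₗ ∎
  where
  open ≡-Reasoning
  P V rₗ dₗ : ℕ
  P = prodℕ m (r ∘ suc ∘ inject₁)
  V = value m (r ∘ suc ∘ inject₁) (d ∘ suc ∘ inject₁)
  rₗ = r (fromℕ (suc m))
  dₗ = d (fromℕ (suc m))
  regroup : ∀ x y z u w → x * (y * z) + (u * z + w) ≡ (x * y + u) * z + w
  regroup = solve-∀

value-< : ∀ m (r d : Fin m → ℕ) → (∀ j → d j < r j) → value m r d < prodℕ m r
value-< zero    r d d<r = s≤s z≤n
value-< (suc m) r d d<r = begin-strict
  d zero * P + value m (r ∘ suc) (d ∘ suc) <⟨ ℕ.+-monoʳ-< (d zero * P) (value-< m (r ∘ suc) (d ∘ suc) (d<r ∘ suc)) ⟩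
  d zero * P + P                           ≡⟨ ℕ.+-comm (d zero * P) P ⟩
  suc (d zero) * P                         ≤⟨ ℕ.*-monoˡ-≤ P (d<r zero) ⟩
  r zero * P                               ∎
  where
  open ℕ.≤-Reasoning
  P : ℕ
  P = prodℕ m (r ∘ suc)

quotRem-unique : ∀ {M} q q′ {x y} → x < M → y < M → q * M + x ≡ q′ * M + y → q ≡ q′ × x ≡ y
quotRem-unique zero    zero     x<M y<M eq = refl , eq
quotRem-unique {M} zero (suc q′) {x} {y} x<M y<M eq =
  ⊥-elim (ℕ.<⇒≱ x<M (subst (M ≤_) (sym eq) (ℕ.≤-trans (ℕ.m≤m+n M (q′ * M)) (ℕ.m≤m+n _ y))))
quotRem-unique {M} (suc q) zero {x} {y} x<M y<M eq =
  ⊥-elim (ℕ.<⇒≱ y<M (subst (M ≤_) eq (ℕ.≤-trans (ℕ.m≤m+n M (q * M)) (ℕ.m≤m+n _ x))))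
quotRem-unique {M} (suc q) (suc q′) {x} {y} x<M y<M eq
  with q≡q′ , x≡y ← quotRem-unique q q′ x<M y<M
         (ℕ.+-cancelˡ-≡ M _ _ (trans (sym (ℕ.+-assoc M (q * M) x)) (trans eq (ℕ.+-assoc M (q′ * M) y))))
  = cong suc q≡q′ , x≡y

value-injective : ∀ m (r d d′ : Fin m → ℕ) → (∀ j → d j < r j) → (∀ j → d′ j < r j) →
                  value m r d ≡ value m r d′ → ∀ j → d j ≡ d′ j
value-injective (suc m) r d d′ d<r d′<r eq
  with quotRem-unique (d zero) (d′ zero)
         (value-< m (r ∘ suc) (d ∘ suc) (d<r ∘ suc)) (value-< m (r ∘ suc) (d′ ∘ suc) (d′<r ∘ suc)) eq
... | d₀≡d′₀ , rest≡ = λ where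
  zero    → d₀≡d′₀
  (suc j) → value-injective m (r ∘ suc) (d ∘ suc) (d′ ∘ suc) (d<r ∘ suc) (d′<r ∘ suc) rest≡ j

-- Most significant digit first, matching how Defs._⊗_ splits its indices.
digits : (m : ℕ) (r : Fin m → ℕ) → Fin (prodℕ m r) → (j : Fin m) → Fin (r j)
digits (suc m) r x zero    = quotient (prodℕ m (r ∘ suc)) x
digits (suc m) r x (suc j) = digits m (r ∘ suc) (remainder {r zero} (prodℕ m (r ∘ suc)) x) j

toℕ-digits : ∀ m (r : Fin m → ℕ) (x : Fin (prodℕ m r)) → toℕ x ≡ value m r (toℕ ∘ digits m r x)
toℕ-digits zero    r zero = refl
toℕ-digits (suc m) r x = begin
  toℕ x                                ≡⟨ cong toℕ (sym (combine-remQuot {r zero} P x)) ⟩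
  toℕ (combine q x′)                   ≡⟨ toℕ-combine q x′ ⟩
  P * toℕ q + toℕ x′                   ≡⟨ cong₂ _+_ (ℕ.*-comm P (toℕ q)) (toℕ-digits m (r ∘ suc) x′) ⟩
  toℕ q * P + value m (r ∘ suc) (toℕ ∘ digits m (r ∘ suc) x′) ∎
  where
  open ≡-Reasoning
  P : ℕ
  P = prodℕ m (r ∘ suc)
  q : Fin (r zero)
  q = quotient {r zero} P x
  x′ : Fin P
  x′ = remainder {r zero} P x

rotate : ∀ {m} → Fin (suc m) → Fin (suc m)
rotate {m} zero = fromℕ m
rotate (suc j)  = inject₁ j

cycle⁻¹≗rotate : ∀ {m} (σ : Permutation′ (suc m)) →
                 (∀ j → toℕ (σ ⟨$⟩ʳ j) ≡ (toℕ j + 1) % suc m) → ∀ j → σ ⟨$⟩ˡ j ≡ rotate j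
cycle⁻¹≗rotate {m} σ σ≡+1 j = trans (cong (σ ⟨$⟩ˡ_) (sym (σ∘rotate j))) (inverseˡ σ)
  where
  σ∘rotate : ∀ j → σ ⟨$⟩ʳ rotate j ≡ j
  σ∘rotate zero = toℕ-injective (begin
    toℕ (σ ⟨$⟩ʳ fromℕ m)        ≡⟨ σ≡+1 (fromℕ m) ⟩
    (toℕ (fromℕ m) + 1) % suc m ≡⟨ cong (λ i → (i + 1) % suc m) (toℕ-fromℕ m) ⟩
    (m + 1) % suc m             ≡⟨ cong (_% suc m) (ℕ.+-comm m 1) ⟩
    suc m % suc m               ≡⟨ n%n≡0 (suc m) ⟩
    0                           ∎)
    where open ≡-Reasoning
  σ∘rotate (suc j) = toℕ-injective (begin
    toℕ (σ ⟨$⟩ʳ inject₁ j)         ≡⟨ σ≡+1 (inject₁ j) ⟩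
    (toℕ (inject₁ j) + 1) % suc m ≡⟨ cong (λ i → (i + 1) % suc m) (toℕ-inject₁ j) ⟩
    (toℕ j + 1) % suc m           ≡⟨ cong (_% suc m) (ℕ.+-comm (toℕ j) 1) ⟩
    suc (toℕ j) % suc m           ≡⟨ m<n⇒m%n≡m (s≤s (toℕ<n j)) ⟩
    suc (toℕ j)                   ∎)
    where open ≡-Reasoning

value-rotate : ∀ m (r d : Fin (suc m) → ℕ) {p : Fin (suc m) → Fin (suc m)} → (∀ j → p j ≡ rotate j) →
  value (suc m) (r ∘ p) (d ∘ p) ≡ d (fromℕ m) * prodℕ m (r ∘ inject₁) + value m (r ∘ inject₁) (d ∘ inject₁)
value-rotate m r d p≗rotate = value-cong (suc m) (cong r ∘ p≗rotate) (cong d ∘ p≗rotate)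

-- The leading digit of T ∘ rotate is the last digit of T, so both directions
-- come down to uniqueness of quotient and remainder.
module RotatedDigits {m} (r : Fin (suc m) → ℕ)
  {p : Fin (suc m) → Fin (suc m)} (p≗rotate : ∀ j → p j ≡ rotate j)
  {S T : Fin (suc m) → ℕ} (S<r∘p : ∀ j → S j < r (p j)) (T<r : ∀ j → T j < r j)
  {a b : ℕ} (a<rₗ : a < r (fromℕ m)) (b<P : b < prodℕ m (r ∘ inject₁))
  (S≡a·P+b : value (suc m) (r ∘ p) S ≡ a * prodℕ m (r ∘ inject₁) + b) where

  private
    P Tₗ V : ℕ
    P = prodℕ m (r ∘ inject₁)
    Tₗ = T (fromℕ m)
    V = value m (r ∘ inject₁) (T ∘ inject₁)

    V<P : V < P
    V<P = value-< m (r ∘ inject₁) (T ∘ inject₁) (T<r ∘ inject₁)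

    T∘p≡Tₗ·P+V : value (suc m) (r ∘ p) (T ∘ p) ≡ Tₗ * P + V
    T∘p≡Tₗ·P+V = value-rotate m r T p≗rotate

  rotated⇒value : (∀ j → S j ≡ T (p j)) → value (suc m) r T ≡ b * r (fromℕ m) + a
  rotated⇒value S≗T∘p
    with Tₗ≡a , V≡b ← quotRem-unique Tₗ a V<P b<P
           (trans (sym T∘p≡Tₗ·P+V) (trans (value-cong (suc m) {r = r ∘ p} (λ _ → refl) (sym ∘ S≗T∘p)) S≡a·P+b))
    = trans (value-init-last m r T) (cong₂ _+_ (cong (_* r (fromℕ m)) V≡b) Tₗ≡a)

  value⇒rotated : value (suc m) r T ≡ b * r (fromℕ m) + a → ∀ j → S j ≡ T (p j)
  value⇒rotated T≡b·rₗ+a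
    with V≡b , Tₗ≡a ← quotRem-unique V b (T<r (fromℕ m)) a<rₗ (trans (sym (value-init-last m r T)) T≡b·rₗ+a)
    = value-injective (suc m) (r ∘ p) S (T ∘ p) S<r∘p (T<r ∘ p)
        (trans S≡a·P+b (sym (trans T∘p≡Tₗ·P+V (cong₂ _+_ (cong (_* P) Tₗ≡a) V≡b))))

MultiIndex : (m : ℕ) → (Fin m → ℕ) → Set
MultiIndex m n = (j : Fin m) → Fin (n j)

module _ {c ℓ} (R : CommutativeRing c ℓ) where
  open CommutativeRing R
    renaming (_+_ to _⊕_; _*_ to _·_; refl to ≈-refl; sym to ≈-sym; trans to ≈-trans) hiding (zero)
  open import Algebra.Properties.Semiring.Exp semiring using (_^_; ^-homo-*; ^-assocʳ)
  open import Algebra.Properties.CommutativeMonoid.Sum +-commutativeMonoid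
    using (sum; sum-remove; sum-cong-≋; sum-replicate-zero)
  open import Relation.Binary.Reasoning.Setoid setoid

  pow≡^ : ∀ x n → pow R x n ≡ x ^ n
  pow≡^ x zero    = refl
  pow≡^ x (suc n) = cong (x ·_) (pow≡^ x n)

  pow-+ : ∀ x m n → pow R x (m + n) ≈ pow R x m · pow R x n
  pow-+ x m n = begin
    pow R x (m + n)           ≡⟨ pow≡^ x (m + n) ⟩
    x ^ (m + n)               ≈⟨ ^-homo-* x m n ⟩
    x ^ m · x ^ n             ≡⟨ sym (cong₂ _·_ (pow≡^ x m) (pow≡^ x n)) ⟩
    pow R x m · pow R x n     ∎

  pow-* : ∀ x m n → pow R x (m * n) ≈ pow R (pow R x m) n
  pow-* x m n = begin
    pow R x (m * n)           ≡⟨ pow≡^ x (m * n) ⟩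
    x ^ (m * n)               ≈⟨ ^-assocʳ x m n ⟨
    (x ^ m) ^ n               ≡⟨ sym (trans (pow≡^ (pow R x m) n) (cong (_^ n) (pow≡^ x m))) ⟩
    pow R (pow R x m) n       ∎

  pow-periodic : ∀ {x N} → pow R x N ≈ 1# → ∀ q e → pow R x (q * N + e) ≈ pow R x e
  pow-periodic             xᴺ≈1 zero    e = ≈-refl
  pow-periodic {x} {N} xᴺ≈1 (suc q) e = begin
    pow R x ((N + q * N) + e)         ≡⟨ cong (pow R x) (ℕ.+-assoc N (q * N) e) ⟩
    pow R x (N + (q * N + e))         ≈⟨ pow-+ x N (q * N + e) ⟩
    pow R x N · pow R x (q * N + e)   ≈⟨ *-cong xᴺ≈1 (pow-periodic xᴺ≈1 q e) ⟩
    1# · pow R x e                    ≈⟨ *-identityˡ _ ⟩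
    pow R x e                         ∎

  sumFin≡sum : ∀ n (f : Fin n → Carrier) → sumFin R n f ≡ sum f
  sumFin≡sum zero    f = refl
  sumFin≡sum (suc n) f = cong (f zero ⊕_) (sumFin≡sum n (f ∘ suc))

  sumFin-single : ∀ n (f : Fin n → Carrier) i → (∀ j → j ≢ i → f j ≈ 0#) → sumFin R n f ≈ f i
  sumFin-single (suc n) f i f≈0 = begin
    sumFin R (suc n) f          ≡⟨ sumFin≡sum (suc n) f ⟩
    sum f                       ≈⟨ sum-remove f ⟩
    f i ⊕ sum (removeAt f i)    ≈⟨ +-congˡ (sum-cong-≋ (λ j → f≈0 _ (punchInᵢ≢i i j))) ⟩
    f i ⊕ sum (replicate n 0#)  ≈⟨ +-congˡ (sum-replicate-zero n) ⟩
    f i ⊕ 0#                    ≈⟨ +-identityʳ (f i) ⟩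
    f i                         ∎

  sumMulti-single : ∀ m (n : Fin m → ℕ) (g : MultiIndex m n → Carrier) (y : MultiIndex m n) {v} →
    (∀ (i : MultiIndex m n) → (∀ j → i j ≡ y j) → g i ≈ v) →
    (∀ (i : MultiIndex m n) j → i j ≢ y j → g i ≈ 0#) → sumMulti R m n g ≈ v
  sumMulti-single zero    n g y at-y off-y = at-y _ (λ ())
  sumMulti-single (suc m) n g y at-y off-y =
    ≈-trans (sumFin-single (n zero) _ (y zero) λ a a≢y₀ →
             sumMulti-single m (n ∘ suc) (g ∘ consIdx {n = n} a) (y ∘ suc)
               (λ i _ → off-y _ zero a≢y₀) (λ i j → off-y _ (suc j)))
          (sumMulti-single m (n ∘ suc) (g ∘ consIdx {n = n} (y zero)) (y ∘ suc)
               (λ i i≗y → at-y _ λ { zero → refl ; (suc j) → i≗y j }) (λ i j → off-y _ (suc j)))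

  E-one : ∀ {a b} {i x : Fin a} {j y : Fin b} → x ≡ i → y ≡ j → E R a b i j x y ≈ 1#
  E-one {i = i} {x} {j} {y} x≡i y≡j with x ≟ i | y ≟ j
  ... | yes _   | yes _   = ≈-refl
  ... | no x≢i  | _       = ⊥-elim (x≢i x≡i)
  ... | yes _   | no y≢j  = ⊥-elim (y≢j y≡j)

  E-zero-row : ∀ {a b} {i x : Fin a} {j y : Fin b} → x ≢ i → E R a b i j x y ≈ 0#
  E-zero-row {i = i} {x} x≢i with x ≟ i
  ... | yes x≡i = ⊥-elim (x≢i x≡i)
  ... | no _    = ≈-refl

  E-zero-column : ∀ {a b} {i x : Fin a} {j y : Fin b} → y ≢ j → E R a b i j x y ≈ 0#
  E-zero-column {i = i} {x} {j} {y} y≢j with x ≟ i | y ≟ j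
  ... | _     | yes y≡j = ⊥-elim (y≢j y≡j)
  ... | yes _ | no _    = ≈-refl
  ... | no _  | no _    = ≈-refl

  kron-one : ∀ m (r s : Fin m → ℕ) (A : (j : Fin m) → Matrix R (r j) (s j)) x y →
    (∀ j → A j (digits m r x j) (digits m s y j) ≈ 1#) → kron R m r s A x y ≈ 1#
  kron-one zero    r s A x y A≈1 = ≈-refl
  kron-one (suc m) r s A x y A≈1 =
    ≈-trans (*-cong (A≈1 zero) (kron-one m (r ∘ suc) (s ∘ suc) (A ∘ suc) _ _ (A≈1 ∘ suc))) (*-identityˡ 1#)

  kron-zero : ∀ m (r s : Fin m → ℕ) (A : (j : Fin m) → Matrix R (r j) (s j)) x y j →
    A j (digits m r x j) (digits m s y j) ≈ 0# → kron R m r s A x y ≈ 0#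
  kron-zero (suc m) r s A x y zero    A≈0 = ≈-trans (*-congʳ A≈0) (zeroˡ _)
  kron-zero (suc m) r s A x y (suc j) A≈0 =
    ≈-trans (*-congˡ (kron-zero m (r ∘ suc) (s ∘ suc) (A ∘ suc) _ _ j A≈0)) (zeroʳ _)

  module ShuffleEntry (m : ℕ) (n : Fin m → ℕ) (σ : Permutation′ m)
    (s : Fin (prodℕ m (n ∘ (σ ⟨$⟩ˡ_)))) (t : Fin (prodℕ m n)) where
    private
      p : Fin m → Fin m
      p = σ ⟨$⟩ˡ_
      sᵈ : (j : Fin m) → Fin (n (p j))
      sᵈ = digits m (n ∘ p) s
      tᵈ : MultiIndex m n
      tᵈ = digits m n t
      blocks : MultiIndex m n → (j : Fin m) → Matrix R (n (p j)) (n j)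
      blocks i j = E R (n (p j)) (n j) (i (p j)) (i j)
      term : MultiIndex m n → Carrier
      term i = kron R m (n ∘ p) n (blocks i) s t

      term-off : ∀ (i : MultiIndex m n) j → i j ≢ tᵈ j → term i ≈ 0#
      term-off i j i≢t = kron-zero m (n ∘ p) n (blocks i) s t j (E-zero-column (i≢t ∘ sym))

    shuffle-one : (∀ j → sᵈ j ≡ tᵈ (p j)) → shuffle R m n σ s t ≈ 1#
    shuffle-one s≗t∘p = sumMulti-single m n term tᵈ
      (λ i i≗t → kron-one m (n ∘ p) n (blocks i) s t λ j →
                   E-one (trans (s≗t∘p j) (sym (i≗t (p j)))) (sym (i≗t j)))
      term-off

    shuffle-zero : ¬ (∀ j → sᵈ j ≡ tᵈ (p j)) → shuffle R m n σ s t ≈ 0#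
    shuffle-zero s≉t∘p with j , s≢t∘p ← ¬∀⟶∃¬ m _ (λ j → sᵈ j ≟ tᵈ (p j)) s≉t∘p =
      sumMulti-single m n term tᵈ
        (λ i i≗t → kron-zero m (n ∘ p) n (blocks i) s t j (E-zero-row (λ s≡i → s≢t∘p (trans s≡i (i≗t (p j))))))
        term-off

  module CyclicShuffleRow {k} (n : Fin (suc (suc k)) → ℕ) (σ : Permutation′ (suc (suc k)))
    (σ≡+1 : ∀ j → toℕ (σ ⟨$⟩ʳ j) ≡ (toℕ j + 1) % suc (suc k))
    {kk b : ℕ} (kk<nₘ : kk < n (fromℕ (suc k))) (b<M : b < prodℕ (suc k) (n ∘ inject₁))
    (s : Fin (prodℕ (suc (suc k)) (n ∘ (σ ⟨$⟩ˡ_))))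
    (s≡kk·M+b : toℕ s ≡ kk * prodℕ (suc k) (n ∘ inject₁) + b) where
    private
      m : ℕ
      m = suc (suc k)
      p : Fin m → Fin m
      p = σ ⟨$⟩ˡ_
      module Rotated (t : Fin (prodℕ m n)) =
        RotatedDigits n (cycle⁻¹≗rotate σ σ≡+1)
          {S = toℕ ∘ digits m (n ∘ p) s} {T = toℕ ∘ digits m n t}
          (λ j → toℕ<n (digits m (n ∘ p) s j)) (λ j → toℕ<n (digits m n t j)) kk<nₘ b<M
          (trans (sym (toℕ-digits m (n ∘ p) s)) s≡kk·M+b)

    shuffle-row-one : ∀ t → toℕ t ≡ b * n (fromℕ (suc k)) + kk → shuffle R m n σ s t ≈ 1#
    shuffle-row-one t t≡b·nₘ+kk = ShuffleEntry.shuffle-one m n σ s t λ j →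
      toℕ-injective (Rotated.value⇒rotated t (trans (sym (toℕ-digits m n t)) t≡b·nₘ+kk) j)

    shuffle-row-zero : ∀ t → toℕ t ≢ b * n (fromℕ (suc k)) + kk → shuffle R m n σ s t ≈ 0#
    shuffle-row-zero t t≢b·nₘ+kk = ShuffleEntry.shuffle-zero m n σ s t λ s≗t∘p →
      t≢b·nₘ+kk (trans (toℕ-digits m n t) (Rotated.rotated⇒value t (cong toℕ ∘ s≗t∘p)))

  ·M-transpose-unit-row : ∀ {a b d} (A : Matrix R a b) (P : Matrix R d b) i j t →
    P j t ≈ 1# → (∀ t′ → t′ ≢ t → P j t′ ≈ 0#) → _·M_ R A (transpose R P) i j ≈ A i t
  ·M-transpose-unit-row A P i j t P≈1 P≈0 = begin
    _·M_ R A (transpose R P) i j ≈⟨ sumFin-single _ _ t (λ t′ t′≢t → ≈-trans (*-congˡ (P≈0 t′ t′≢t)) (zeroʳ _)) ⟩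
    A i t · P j t                ≈⟨ *-congˡ P≈1 ⟩
    A i t · 1#                   ≈⟨ *-identityʳ _ ⟩
    A i t                        ∎

  D-·M : ∀ {s b} z (B : Matrix R s b) i j → _·M_ R (D R s z) B i j ≈ pow R z (toℕ i) · B i j
  D-·M z B i j = ≈-trans (sumFin-single _ _ i off-diagonal) (*-congʳ diagonal)
    where
    diagonal : D R _ z i i ≈ pow R z (toℕ i)
    diagonal with i ≟ i
    ... | yes _   = ≈-refl
    ... | no i≢i  = ⊥-elim (i≢i refl)

    off-diagonal : ∀ t → t ≢ i → D R _ z i t · B t j ≈ 0#
    off-diagonal t t≢i with i ≟ t
    ... | yes i≡t = ⊥-elim (t≢i (sym i≡t))
    ... | no _    = zeroˡ _

  block-exponent : ∀ x M nₘ → pow R x (M * nₘ) ≈ 1# → ∀ h a b kk →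
    pow R x ((h * M + a) * (b * nₘ + kk)) ≈ pow R x (M * h * kk) · (pow R (pow R x kk) a · pow R (pow R x nₘ) (a * b))
  block-exponent x M nₘ xᴹⁿ≈1 h a b kk = begin
    pow R x ((h * M + a) * (b * nₘ + kk))                   ≡⟨ cong (pow R x) (expand h M a b nₘ kk) ⟩
    pow R x ((h * b) * (M * nₘ) + (M * h * kk + (kk * a + nₘ * (a * b))))
                                                            ≈⟨ pow-periodic xᴹⁿ≈1 (h * b) _ ⟩
    pow R x (M * h * kk + (kk * a + nₘ * (a * b)))          ≈⟨ pow-+ x (M * h * kk) _ ⟩
    pow R x (M * h * kk) · pow R x (kk * a + nₘ * (a * b))  ≈⟨ *-congˡ (pow-+ x (kk * a) _) ⟩
    pow R x (M * h * kk) · (pow R x (kk * a) · pow R x (nₘ * (a * b)))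
                                                            ≈⟨ *-congˡ (*-cong (pow-* x kk a) (pow-* x nₘ (a * b))) ⟩
    pow R x (M * h * kk) · (pow R (pow R x kk) a · pow R (pow R x nₘ) (a * b)) ∎
    where
    expand : ∀ h M a b nₘ kk →
      (h * M + a) * (b * nₘ + kk) ≡ (h * b) * (M * nₘ) + (M * h * kk + (kk * a + nₘ * (a * b)))
    expand = solve-∀

proposition5p2 : ∀ {c ℓ} (R : CommutativeRing c ℓ) (k : ℕ) →
    let m = suc (suc k) in
    (n : Fin m → ℕ) → (∀ j → 2 ≤ n j) →
    (σ : Permutation′ m) → (∀ j → toℕ (σ ⟨$⟩ʳ j) ≡ (toℕ j + 1) % m) →
    let N = prodℕ m n
        nm = n (fromℕ (suc k))
        M = prodℕ (suc k) (λ j → n (inject₁ j))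
    in (ω : CommutativeRing.Carrier R) → CommutativeRing._≈_ R (pow R ω N) (CommutativeRing.1# R) →
    (∀ t → 0 < t → t < N → ¬ CommutativeRing._≈_ R (pow R ω t) (CommutativeRing.1# R)) →
    (h kk : Fin nm) (a b : Fin M)
    (r : Fin N) (s : Fin (prodℕ m (λ j → n (σ ⟨$⟩ˡ j)))) →
    toℕ r ≡ toℕ h * M + toℕ a → toℕ s ≡ toℕ kk * M + toℕ b →
    CommutativeRing._≈_ R
      (_·M_ R (F R N ω) (transpose R (shuffle R m n σ)) r s)
      (scale R (pow R ω (M * toℕ h * toℕ kk))
                (_·M_ R (D R M (pow R ω (toℕ kk))) (F R M (pow R ω nm))) a b)
proposition5p2 R k n _ σ σ≡+1 ω ωᴺ≈1 _ h kk a b r s r≡h·M+a s≡kk·M+b = begin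
  _·M_ R (F R N ω) (transpose R (shuffle R m n σ)) r s
    ≈⟨ ·M-transpose-unit-row R (F R N ω) (shuffle R m n σ) r s t (shuffle-row-one t toℕ-t)
         (λ t′ t′≢t → shuffle-row-zero t′ λ t′≡ → t′≢t (toℕ-injective (trans t′≡ (sym toℕ-t)))) ⟩
  pow R ω (toℕ r * toℕ t)
    ≡⟨ cong₂ (λ i j → pow R ω (i * j)) r≡h·M+a toℕ-t ⟩
  pow R ω ((toℕ h * M + toℕ a) * (toℕ b * nₘ + toℕ kk))
    ≈⟨ block-exponent R ω M nₘ (subst (λ e → pow R ω e ≈ 1#) N≡M·nₘ ωᴺ≈1) (toℕ h) (toℕ a) (toℕ b) (toℕ kk) ⟩
  pow R ω (M * toℕ h * toℕ kk) · (pow R (pow R ω (toℕ kk)) (toℕ a) · F R M (pow R ω nₘ) a b)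
    ≈⟨ *-congˡ (≈-sym (D-·M R (pow R ω (toℕ kk)) (F R M (pow R ω nₘ)) a b)) ⟩
  scale R (pow R ω (M * toℕ h * toℕ kk)) (_·M_ R (D R M (pow R ω (toℕ kk))) (F R M (pow R ω nₘ))) a b ∎
  where
  open CommutativeRing R
    using (_≈_; 1#; setoid; *-congˡ) renaming (_*_ to _·_; sym to ≈-sym)
  open import Relation.Binary.Reasoning.Setoid setoid
  m N nₘ M : ℕ
  m = suc (suc k)
  N = prodℕ m n
  nₘ = n (fromℕ (suc k))
  M = prodℕ (suc k) (n ∘ inject₁)
  N≡M·nₘ : N ≡ M * nₘ
  N≡M·nₘ = prodℕ-init-last (suc k) n
  b·nₘ+kk<N : toℕ b * nₘ + toℕ kk < N
  b·nₘ+kk<N = subst₂ _<_ (trans (toℕ-combine b kk) (cong (_+ toℕ kk) (ℕ.*-comm nₘ (toℕ b)))) (sym N≡M·nₘ)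
                (toℕ<n (combine b kk))
  t : Fin N
  t = fromℕ< b·nₘ+kk<N
  toℕ-t : toℕ t ≡ toℕ b * nₘ + toℕ kk
  toℕ-t = toℕ-fromℕ< b·nₘ+kk<N
  open CyclicShuffleRow R n σ σ≡+1 (toℕ<n kk) (toℕ<n b) s s≡kk·M+b
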